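{- Let $n$ be a cbc Haj\'{o}s number. Then every $n$-cbc $X$ satisfies the triangle property: for every $k\in\{0,1,\dots,n-1\}$, $\left|\{x\in X: |x|\le k\}\right|\le k$, where $|x|$ denotes the length of the word $x$.
   Context: Fix an alphabet $\mathcal A$ containing distinct letters $a,b$. A code is a set $X\subseteq\mathcal A^*$ such that $x_1\cdots x_t=y_1\cdots y_{t'}$ with $x_i,y_i\in X$ implies $t=t'$ and $x_i=y_i$ for all $i$. Write $[n]=\{0,\dots,n-1\}$ and $u\bmod n$ for the remainder in $[n]$. An $n$-cbc is a set $X\subseteq a^{[n]}ba^{[n]}$ with $|X|=n$ such that $\{a^n\}\cup X$ is a code. For $n$-cbc $X,Y$ and $r\in[n]$, $X\circ_rY=\{a^iba^\ell: a^iba^j\in X, a^kba^\ell\in Y, (j+k)\bmod n=r\}$; a set $\mathcal E$ of $n$-cbc is compatible if every composition $X_1\circ_{r_1}\cdots\circ_{r_k}X_{k+1}$ ($X_i\in\mathcal E$, $r_i\in[n]$) is an $n$-cbc. Dual: $\overline X=\{a^jba^i:a^iba^j\in X\}$, $\overline{\mathcal E}=\{\overline X:X\in\mathcal E\}$. For an $m$-element set $X=\{a^{i_1}ba^{j_1},\dots,a^{i_m}ba^{j_m}\}\subseteq a^{[m]}ba^{[m]}$ and $t\ge1$, $H_t(X)$ is the set of all sets $\bigcup_{\ell=1}^{m}\{a^{i_\ell+k_{\ell,s}m}ba^{j_\ell+sm}:s=0,\dots,t-1\}$ with $k_{\ell,s}\in[t]$ arbitrary. A set $\mathcal E$ of $n$-cbc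 is of Haj\'{o}s if $\mathcal E=\{\{b\}\}$ ($n=1$) or there exist $k\ge1$ and $t_1,\dots,t_k>1$ such that either for every $Y\in\mathcal E$, or for every $Y\in\overline{\mathcal E}$, there are sets $Y_1,\dots,Y_{k-1}$ with ($Y_0=\{b\}$) $Y\in H_{t_k}(Y_{k-1})$ and $\overline{Y_i}\in H_{t_i}(Y_{i-1})$ for $1\le i\le k-1$. An integer $n$ is a cbc Haj\'{o}s number if every compatible set of $n$-cbc is of Haj\'{o}s. -}

module Defs where

open import Data.Nat using (ℕ; zero; suc; _+_; _*_; _≤_; _<_)
open import Data.List using (List; []; _∷_; _++_; replicate; concat; length)
open import Data.Nat.ListAction using (product)
open import Data.List.Relation.Unary.All using (All)
open import Data.List.Relation.Unary.Unique.Propositional using (Unique)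
open import Data.List.Membership.Propositional using (_∈_)
open import Data.Product using (Σ; ∃; ∃-syntax; _×_; _,_)
open import Data.Sum using (_⊎_)
open import Relation.Binary.PropositionalEquality using (_≡_)
open import Level using (Lift; 0ℓ) renaming (suc to lsuc)

-- Everything is parametrised by an alphabet A with two letters a , b
-- (distinctness a ≢ b is assumed in the main statement).
module Cbc {A : Set} (a b : A) where

  Word : Set
  Word = List A

  WSet : Set₁
  WSet = Word → Set

  _≐_ : WSet → WSet → Set
  X ≐ Y = ∀ w → (X w → Y w) × (Y w → X w)

  aba : ℕ → ℕ → Word
  aba i j = replicate i a ++ (b ∷ replicate j a)

  ｛b｝ : WSet
  ｛b｝ w = w ≡ (b ∷ [])

  IsCode : WSet → Set
  IsCode C = ∀ (xs ys : List Word) → All C xs → All C ys →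
             concat xs ≡ concat ys → xs ≡ ys

  HasSize : WSet → ℕ → Set
  HasSize X n = Σ (List Word) λ xs → Unique xs × length xs ≡ n ×
                  (∀ w → (X w → w ∈ xs) × (w ∈ xs → X w))

  InBox : ℕ → WSet → Set
  InBox n X = ∀ w → X w → ∃[ i ] ∃[ j ] (i < n × j < n × w ≡ aba i j)

  withAn : ℕ → WSet → WSet
  withAn n X w = (w ≡ replicate n a) ⊎ X w

  IsCbc : ℕ → WSet → Set
  IsCbc n X = InBox n X × HasSize X n × IsCode (withAn n X)

  -- u mod n = r, for r ∈ [n] (r < n is required separately where used)
  ModEq : ℕ → ℕ → ℕ → Set
  ModEq n u r = ∃[ q ] (u ≡ r + q * n)

  comp : ℕ → WSet → ℕ → WSet → WSet
  comp n X r Y w = ∃[ i ] ∃[ j ] ∃[ k ] ∃[ l ]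
    (w ≡ aba i l × X (aba i j) × Y (aba k l) × ModEq n (j + k) r)

  -- X₁ ∘_{r₁} X₂ ∘_{r₂} ⋯ ∘_{r_k} X_{k+1}  (composition is associative;
  -- we bracket to the left)
  compAll : ℕ → WSet → List (ℕ × WSet) → WSet
  compAll n X [] = X
  compAll n X ((r , Y) ∷ rest) = compAll n (comp n X r Y) rest

  Compatible : ℕ → (WSet → Set) → Set₁
  Compatible n E =
    (∀ X → E X → IsCbc n X) ×
    (∀ X → E X → ∀ (r : ℕ) (Y : WSet) (rest : List (ℕ × WSet)) →
       r < n → E Y → All (λ p → Data.Product.proj₁ p < n × E (Data.Product.proj₂ p)) rest →
       IsCbc n (compAll n X ((r , Y) ∷ rest)))

  dual : WSet → WSet
  dual X w = ∃[ i ] ∃[ j ] (w ≡ aba j i × X (aba i j))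

  -- Y ∈ H_t(X), for X an m-element subset of a^[m] b a^[m].
  -- The element a^{i_ℓ} b a^{j_ℓ} of X is indexed by its exponent pair (i_ℓ , j_ℓ);
  -- k i j s plays the role of k_{ℓ,s} ∈ [t].
  InH : ℕ → ℕ → WSet → WSet → Set
  InH t m X Y = Σ (ℕ → ℕ → ℕ → ℕ) λ k → (∀ i j s → k i j s < t) ×
    (Y ≐ λ w → ∃[ i ] ∃[ j ] ∃[ s ]
          (X (aba i j) × s < t × w ≡ aba (i + k i j s * m) (j + s * m)))

  -- Chain rs Y : Y is a valid Y_i for the sequence rs = t_i ∷ t_{i-1} ∷ ⋯ ∷ t_1
  -- (listed in reverse), i.e. Y_0 = {b} and dual(Y_i) ∈ H_{t_i}(Y_{i-1}).
  -- The size of Y_{i-1} is m = t_1 ⋯ t_{i-1} = product of the tail.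
  Chain : List ℕ → WSet → Set₁
  Chain [] Y = Lift (lsuc 0ℓ) (Y ≐ ｛b｝)
  Chain (t ∷ rs) Y = Σ WSet λ Yp → Chain rs Yp × InH t (product rs) Yp (dual Y)

  -- Final (t_k ∷ t_{k-1} ∷ ⋯ ∷ t_1) Y : there are Y_1,…,Y_{k-1} as above
  -- with Y ∈ H_{t_k}(Y_{k-1}).
  Final : ℕ → List ℕ → WSet → Set₁
  Final t rs Y = Σ WSet λ Yp → Chain rs Yp × InH t (product rs) Yp Y

  IsHajos : ℕ → (WSet → Set) → Set₁
  IsHajos n E =
    (n ≡ 1 × (∀ Y → E Y → Y ≐ ｛b｝) × (Σ WSet λ Y → E Y × Y ≐ ｛b｝))
    ⊎ (Σ ℕ λ t → Σ (List ℕ) λ rs → All (1 <_) (t ∷ rs) ×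
        ((∀ Y → E Y → Final t rs Y) ⊎ (∀ X → E X → Final t rs (dual X))))

  CbcHajosNumber : ℕ → Set₁
  CbcHajosNumber n = ∀ (E : WSet → Set) → Compatible n E → IsHajos n E

  Triangle : ℕ → WSet → Set
  Triangle n X = ∀ k → k < n → ∀ (ys : List Word) → Unique ys →
    All (λ w → X w × length w ≤ k) ys → length ys ≤ k

{-# OPTIONS --safe #-}
-- Let X be an n-cbc. Every composition X ∘_{r₁} X ∘ ⋯ ∘_{r_k} X is again an n-cbc. Its words are
-- the words a^i b a^l spelled by sequences of words of X in which consecutive exponents j, k satisfy
-- j + k ≡ r (mod n), with aⁿ inserted whenever j + k < n. Substituting the spelling for the letter b
-- turns factorisations over the composition into factorisations over X ∪ {aⁿ}, so the composition is
-- a code. It has n elements: the n² pairs (word of the previous composition, word of X) fall into n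
-- residue classes, each injecting into a code of this shape, and such a code has at most n elements,
-- since m + 1 of its words in a row are determined by m + 2 numbers below n. Hence {X} is compatible,
-- so it is of Hajós, and X or its dual lies in H_t(Y) for some Y of a Hajós chain.
-- The triangle property, strengthened to |{(i , j) ∈ P : i + j + 1 ≤ K}| ≤ min(K , m) for P ⊆ [m]²,
-- holds for {b}, survives duals, and passes from P to every member of H_t(P): reducing modulo m maps
-- the pairs with j in block s injectively into the pairs of P of length at most K − s m.
module Submission where

open import Defs
open import Data.Bool using (Bool; true; false)
open import Data.Empty using (⊥-elim)
open import Data.Fin as Fin using (Fin; toℕ; fromℕ<; funToFin; finToFun)
open import Data.Fin.Properties using (toℕ-fromℕ<; funToFin-finToFin; finToFun-funToFin; injective⇒≤)
open import Data.List as List using (List; []; _∷_; _++_; _ʳ++_; replicate; concat; length; map; filter; cartesianProduct)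
open import Data.List.Properties using (++-monoid; length-map; length-++; length-replicate; filter-accept; filter-reject; ++-assoc; ++-identityʳ; concat-++; map-++; map-replicate; map-injective; ∷-injective; ∷-injectiveˡ; ∷-injectiveʳ; ∷ʳ-injectiveʳ)
open import Data.List.Membership.Propositional using (_∈_)
open import Data.List.Membership.Propositional.Properties using (∈-lookup; ∈-map⁺; ∈-map⁻; ∈-filter⁺; ∈-cartesianProduct⁺; ∈-cartesianProduct⁻)
open import Data.List.Relation.Unary.All as All using (All; []; _∷_)
import Data.List.Relation.Unary.All.Properties as All
open import Data.List.Relation.Unary.AllPairs using ([]; _∷_)
open import Data.List.Relation.Unary.Unique.Propositional using (Unique)
import Data.List.Relation.Unary.Unique.Propositional.Properties as Unique
open import Data.Nat using (ℕ; zero; suc; _+_; _*_; _∸_; _^_; _≤_; _<_; _⊓_; z≤n; s≤s; s≤s⁻¹; _≟_; _<?_; NonZero)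
open import Data.Nat.DivMod using (_%_; _/_; _mod_; [m+kn]%n≡m%n; m≡m%n+[m/n]*n; m%n<n; m<n⇒m%n≡m; m≤n⇒[n∸m]%m≡n%m)
open import Data.Nat.ListAction using (product)
open import Data.Nat.Properties
open import Algebra.Properties.CommutativeSemigroup +-commutativeSemigroup using (interchange; x∙yz≈y∙xz)
open import Data.Nat.Tactic.RingSolver using (solve-∀)
open import Data.Product as Product using (Σ-syntax; ∃-syntax; _×_; _,_; proj₁; proj₂)
open import Data.Sum using (_⊎_; inj₁; inj₂)
open import Function using (_∘_; id)
open import Level using (lift)
open import Relation.Binary.PropositionalEquality using (_≡_; _≢_; refl; sym; trans; cong; cong₂; subst; module ≡-Reasoning)
open import Relation.Nullary using (¬_; yes; no)
open import Relation.Unary using (Decidable)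
open import Relation.Unary.Properties using (∁?)
open import Tactic.MonoidSolver using (solve)

module _ {C : Set} where

  All-¬⇒≡[] : ∀ {P : C → Set} {xs} → (∀ {x} → ¬ P x) → All P xs → xs ≡ []
  All-¬⇒≡[] ¬p [] = refl
  All-¬⇒≡[] ¬p (p ∷ _) = ⊥-elim (¬p p)

  length-filter+filter-∁ : ∀ {P : C → Set} (P? : Decidable P) xs →
    length (filter P? xs) + length (filter (∁? P?) xs) ≡ length xs
  length-filter+filter-∁ P? [] = refl
  length-filter+filter-∁ P? (x ∷ xs) with P? x
  ... | yes _ = cong suc (length-filter+filter-∁ P? xs)
  ... | no _ = trans (+-suc _ _) (cong suc (length-filter+filter-∁ P? xs))

  unique-map⁺ : ∀ {D : Set} {P : C → Set} (f : C → D) → (∀ {x y} → P x → P y → f x ≡ f y → x ≡ y) →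
    ∀ {xs} → All P xs → Unique xs → Unique (map f xs)
  unique-map⁺ f inj [] [] = []
  unique-map⁺ {P = P} f inj (p ∷ ps) (x∉ ∷ u) = images p ps x∉ ∷ unique-map⁺ f inj ps u
    where
    images : ∀ {x ys} → P x → All P ys → All (x ≢_) ys → All (f x ≢_) (map f ys)
    images p [] [] = []
    images p (q ∷ qs) (v ∷ vs) = (λ e → v (inj p q e)) ∷ images p qs vs

  All-ʳ++⁺ : ∀ {P : C → Set} {xs ys} → All P xs → All P ys → All P (xs ʳ++ ys)
  All-ʳ++⁺ [] pys = pys
  All-ʳ++⁺ (px ∷ pxs) pys = All-ʳ++⁺ pxs (px ∷ pys)

  length-cartesianProduct : ∀ {D : Set} (xs : List C) (ys : List D) →
    length (cartesianProduct xs ys) ≡ length xs * length ys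
  length-cartesianProduct [] ys = refl
  length-cartesianProduct (x ∷ xs) ys = trans (length-++ (map (x ,_) ys))
    (cong₂ _+_ (length-map (x ,_) ys) (length-cartesianProduct xs ys))

n+[j+k]%n≡j+k : ∀ {n j k} .{{_ : NonZero n}} → j < n → k < n → n ≤ j + k → n + (j + k) % n ≡ j + k
n+[j+k]%n≡j+k {n} {j} {k} j<n k<n n≤j+k = begin
  n + (j + k) % n       ≡⟨ cong (n +_) (sym (m≤n⇒[n∸m]%m≡n%m n≤j+k)) ⟩
  n + (j + k ∸ n) % n   ≡⟨ cong (n +_) (m<n⇒m%n≡m j+k∸n<n) ⟩
  n + (j + k ∸ n)       ≡⟨ m+[n∸m]≡n n≤j+k ⟩
  j + k                 ∎
  where
  open ≡-Reasoning
  j+k∸n<n : j + k ∸ n < n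
  j+k∸n<n = +-cancelˡ-< n _ _ (subst (_< n + n) (sym (m+[n∸m]≡n n≤j+k)) (+-mono-< j<n k<n))

replicate-++ : ∀ {C : Set} m n (x : C) → replicate m x ++ replicate n x ≡ replicate (m + n) x
replicate-++ zero n x = refl
replicate-++ (suc m) n x = cong (x ∷_) (replicate-++ m n x)

lookup-injective : ∀ {C : Set} {xs : List C} → Unique xs → ∀ {i j} → List.lookup xs i ≡ List.lookup xs j → i ≡ j
lookup-injective (_ ∷ _) {Fin.zero} {Fin.zero} _ = refl
lookup-injective (x∉ ∷ _) {Fin.zero} {Fin.suc j} e = ⊥-elim (All.lookup x∉ (∈-lookup j) e)
lookup-injective (x∉ ∷ _) {Fin.suc i} {Fin.zero} e = ⊥-elim (All.lookup x∉ (∈-lookup i) (sym e))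
lookup-injective (_ ∷ u) {Fin.suc i} {Fin.suc j} e = cong Fin.suc (lookup-injective u e)

funToFin-cong : ∀ {m k} {f g : Fin m → Fin k} → (∀ i → f i ≡ g i) → funToFin f ≡ funToFin g
funToFin-cong {zero} f≗g = refl
funToFin-cong {suc m} f≗g = cong₂ Fin.combine (f≗g Fin.zero) (funToFin-cong (f≗g ∘ Fin.suc))

-- Counting by residues

sumBelow : ℕ → (ℕ → ℕ) → ℕ
sumBelow zero g = 0
sumBelow (suc N) g = sumBelow N g + g N

sumBelow-cong : ∀ N {g h} → (∀ r → g r ≡ h r) → sumBelow N g ≡ sumBelow N h
sumBelow-cong zero e = refl
sumBelow-cong (suc N) e = cong₂ _+_ (sumBelow-cong N e) (e N)

sumBelow-+ : ∀ N g h → sumBelow N (λ r → g r + h r) ≡ sumBelow N g + sumBelow N h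
sumBelow-+ zero g h = refl
sumBelow-+ (suc N) g h = begin
  sumBelow N (λ r → g r + h r) + (g N + h N)   ≡⟨ cong (_+ (g N + h N)) (sumBelow-+ N g h) ⟩
  sumBelow N g + sumBelow N h + (g N + h N)    ≡⟨ interchange (sumBelow N g) _ (g N) (h N) ⟩
  sumBelow N g + g N + (sumBelow N h + h N)    ∎
  where open ≡-Reasoning

sumBelow-≤ : ∀ N {g n} → (∀ r → r < N → g r ≤ n) → sumBelow N g ≤ N * n
sumBelow-≤ zero bound = z≤n
sumBelow-≤ (suc N) {g} {n} bound = subst (sumBelow N g + g N ≤_) (+-comm (N * n) n)
  (+-mono-≤ (sumBelow-≤ N (λ r r<N → bound r (m≤n⇒m≤1+n r<N))) (bound N ≤-refl))

δ : ℕ → ℕ → ℕ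
δ u r with u ≟ r
... | yes _ = 1
... | no _ = 0

sumBelow-δ : ∀ {u} N → u < N → sumBelow N (δ u) ≡ 1
sumBelow-δ {u} (suc N) u<1+N with u ≟ N
... | yes refl = cong (_+ 1) (vanishes u ≤-refl)
  where
  vanishes : ∀ M → M ≤ u → sumBelow M (δ u) ≡ 0
  vanishes zero _ = refl
  vanishes (suc M) M<u with u ≟ M
  ... | yes refl = ⊥-elim (<-irrefl refl M<u)
  ... | no _ = trans (+-identityʳ _) (vanishes M (<⇒≤ M<u))
... | no u≢N = trans (+-identityʳ _) (sumBelow-δ N (≤∧≢⇒< (s≤s⁻¹ u<1+N) u≢N))

module _ {C : Set} (f : C → ℕ) where

  fibre : ℕ → List C → List C
  fibre r = filter (λ x → f x ≟ r)

  length-fibre-∷ : ∀ r x xs → length (fibre r (x ∷ xs)) ≡ δ (f x) r + length (fibre r xs)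
  length-fibre-∷ r x xs with f x ≟ r
  ... | yes fx≡r = cong length (filter-accept (λ y → f y ≟ r) fx≡r)
  ... | no fx≢r = cong length (filter-reject (λ y → f y ≟ r) fx≢r)

  sumBelow-fibres : ∀ N → (∀ x → f x < N) → ∀ xs → sumBelow N (λ r → length (fibre r xs)) ≡ length xs
  sumBelow-fibres N f<N [] = zeros N
    where
    zeros : ∀ M → sumBelow M (λ _ → 0) ≡ 0
    zeros zero = refl
    zeros (suc M) = trans (+-identityʳ _) (zeros M)
  sumBelow-fibres N f<N (x ∷ xs) = begin
    sumBelow N (λ r → length (fibre r (x ∷ xs)))                  ≡⟨ sumBelow-cong N (λ r → length-fibre-∷ r x xs) ⟩
    sumBelow N (λ r → δ (f x) r + length (fibre r xs))            ≡⟨ sumBelow-+ N (δ (f x)) _ ⟩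
    sumBelow N (δ (f x)) + sumBelow N (λ r → length (fibre r xs)) ≡⟨ cong₂ _+_ (sumBelow-δ N (f<N x)) (sumBelow-fibres N f<N xs) ⟩
    suc (length xs)                                               ∎
    where open ≡-Reasoning

+-saturated : ∀ {w x y z} → w ≤ y → x ≤ z → w + x ≡ y + z → w ≡ y × x ≡ z
+-saturated {w} {x} {y} {z} w≤y x≤z e = w≡y , +-cancelˡ-≡ w x z (trans e (cong (_+ z) (sym w≡y)))
  where
  w≡y : w ≡ y
  w≡y = ≤-antisym w≤y (+-cancelʳ-≤ z y w (subst (_≤ w + z) e (+-monoʳ-≤ w x≤z)))

sumBelow-saturated : ∀ N {g n} → (∀ r → r < N → g r ≤ n) → sumBelow N g ≡ N * n → ∀ r → r < N → g r ≡ n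
sumBelow-saturated (suc N) {g} {n} bound total r r<1+N with +-saturated
  (sumBelow-≤ N (λ r r<N → bound r (m≤n⇒m≤1+n r<N))) (bound N ≤-refl) (trans total (+-comm n (N * n)))
... | lower , last with r ≟ N
...   | yes refl = last
...   | no r≢N = sumBelow-saturated N (λ r r<N → bound r (m≤n⇒m≤1+n r<N)) lower r (≤∧≢⇒< (s≤s⁻¹ r<1+N) r≢N)

-- Bernoulli's inequality

-- (1 + 1/n)^k ≥ 1 + k/n, multiplied by n^(k+1).
bernoulli : ∀ n k → n ^ k * (n + k) ≤ n * suc n ^ k
bernoulli n zero = ≤-reflexive (base n)
  where
  base : ∀ n → 1 * (n + 0) ≡ n * 1
  base = solve-∀
bernoulli n (suc k) = begin
  n * n ^ k * (n + suc k)    ≡⟨ regroup n k (n ^ k) ⟩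
  n ^ k * (n * (n + suc k))  ≤⟨ *-monoʳ-≤ (n ^ k) (subst (n * (n + suc k) ≤_) (sym (expand n k)) (m≤m+n _ k)) ⟩
  n ^ k * ((n + k) * suc n)  ≡⟨ sym (*-assoc (n ^ k) (n + k) (suc n)) ⟩
  n ^ k * (n + k) * suc n    ≤⟨ *-monoˡ-≤ (suc n) (bernoulli n k) ⟩
  n * suc n ^ k * suc n      ≡⟨ *-assoc n _ (suc n) ⟩
  n * (suc n ^ k * suc n)    ≡⟨ cong (n *_) (*-comm _ (suc n)) ⟩
  n * (suc n * suc n ^ k)    ∎
  where
  open ≤-Reasoning
  regroup : ∀ n k p → n * p * (n + suc k) ≡ p * (n * (n + suc k))
  regroup = solve-∀
  expand : ∀ n k → (n + k) * suc n ≡ n * (n + suc k) + k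
  expand = solve-∀

≤-of-^-bounds : ∀ {N n} → (∀ m → N ^ suc m ≤ n ^ suc (suc m)) → N ≤ n
≤-of-^-bounds {N} {zero} bound = subst (_≤ 0) (*-identityʳ N) (bound 0)
≤-of-^-bounds {N} {n@(suc n′)} bound = ≮⇒≥ λ n<N → <-irrefl refl (begin-strict
  n * n ^ k       <⟨ *-monoˡ-< (n ^ k) ⦃ m^n≢0 n k ⦄ (n<1+n n) ⟩
  suc n * n ^ k   ≡⟨ *-comm (suc n) (n ^ k) ⟩
  n ^ k * suc n   ≤⟨ *-cancelˡ-≤ n (subst (_≤ n * suc n ^ k) (regroup n (n ^ k)) (bernoulli n k)) ⟩
  suc n ^ k       ≤⟨ ^-monoˡ-≤ k n<N ⟩
  N ^ k           ≤⟨ bound (n′ + n′ * n) ⟩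
  n * n ^ k       ∎)
  where
  open ≤-Reasoning
  k : ℕ
  k = n * n
  regroup : ∀ n p → p * (n + n * n) ≡ n * (p * suc n)
  regroup = solve-∀

-- Triangular sets of exponent pairs

Pair : Set
Pair = ℕ × ℕ

PairSet : Set₁
PairSet = ℕ → ℕ → Set

_⊆₂_ : PairSet → PairSet → Set
P ⊆₂ Q = ∀ {i j} → P i j → Q i j

Flip : PairSet → PairSet
Flip P i j = P j i

InSquare : ℕ → PairSet → Set
InSquare m P = ∀ {i j} → P i j → i < m × j < m

ShortIn : PairSet → ℕ → Pair → Set
ShortIn P K (i , j) = P i j × i + suc j ≤ K

TriangleBound : ℕ → PairSet → Set
TriangleBound m P = ∀ K {ps} → Unique ps → All (ShortIn P K) ps → length ps ≤ K ⊓ m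

Triangular : ℕ → PairSet → Set
Triangular m P = InSquare m P × TriangleBound m P

triangular-⊆ : ∀ {m P Q} → P ⊆₂ Q → Triangular m Q → Triangular m P
triangular-⊆ P⊆Q (square , bound) = square ∘ P⊆Q , λ K u shorts → bound K u (All.map (Product.map₁ P⊆Q) shorts)

triangular-Flip : ∀ {m P} → Triangular m P → Triangular m (Flip P)
triangular-Flip {m} {P} (square , bound) = Product.swap ∘ square , flipped
  where
  flipped : TriangleBound m (Flip P)
  flipped K {ps} u shorts = subst (_≤ K ⊓ m) (length-map Product.swap ps)
    (bound K (Unique.map⁺ swap-injective u) (All.map⁺ (All.map swap-short shorts)))
    where
    swap-injective : ∀ {p q : Pair} → Product.swap p ≡ Product.swap q → p ≡ q
    swap-injective refl = refl
    swap-short : ∀ {p} → ShortIn (Flip P) K p → ShortIn P K (Product.swap p)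
    swap-short {i , j} (pji , len) = pji , subst (_≤ K) (trans (+-comm i (suc j)) (sym (+-suc j i))) len

triangular-origin : ∀ {P} → (∀ {i j} → P i j → i ≡ 0 × j ≡ 0) → Triangular 1 P
triangular-origin {P} origin = square , bound
  where
  square : InSquare 1 P
  square pij with origin pij
  ... | refl , refl = s≤s z≤n , s≤s z≤n
  bound : TriangleBound 1 P
  bound K [] [] = z≤n
  bound K (_ ∷ []) ((pij , len) ∷ []) with origin pij
  ... | refl , refl = ⊓-glb len ≤-refl
  bound K ((p≢q ∷ _) ∷ _) ((pij , _) ∷ (pkl , _) ∷ _) with origin pij | origin pkl
  ... | refl , refl | refl , refl = ⊥-elim (p≢q refl)

m⊓n+[m∸n]⊓o≡m⊓[n+o] : ∀ m n o → m ⊓ n + (m ∸ n) ⊓ o ≡ m ⊓ (n + o)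
m⊓n+[m∸n]⊓o≡m⊓[n+o] zero zero o = refl
m⊓n+[m∸n]⊓o≡m⊓[n+o] zero (suc n) o = refl
m⊓n+[m∸n]⊓o≡m⊓[n+o] (suc m) zero o = refl
m⊓n+[m∸n]⊓o≡m⊓[n+o] (suc m) (suc n) o = cong suc (m⊓n+[m∸n]⊓o≡m⊓[n+o] m n o)

BlowUp : ℕ → ℕ → (ℕ → ℕ → ℕ → ℕ) → PairSet → PairSet
BlowUp t m k P i j = ∃[ i₀ ] ∃[ j₀ ] ∃[ s ] (P i₀ j₀ × s < t × i ≡ i₀ + k i₀ j₀ s * m × j ≡ j₀ + s * m)

square-BlowUp : ∀ {t m k P} → (∀ i j s → k i j s < t) → InSquare m P → InSquare (t * m) (BlowUp t m k P)
square-BlowUp {t} {m} {k} k<t square (i₀ , j₀ , s , pij , s<t , refl , refl) =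
  ≤-trans (+-monoˡ-< (k i₀ j₀ s * m) (proj₁ (square pij))) (*-monoˡ-≤ m (k<t i₀ j₀ s)) ,
  ≤-trans (+-monoˡ-< (s * m) (proj₂ (square pij))) (*-monoˡ-≤ m s<t)

module BlowUpBound {t m : ℕ} .{{_ : NonZero m}} {k : ℕ → ℕ → ℕ → ℕ} {P : PairSet}
                   (square : InSquare m P) (bound : TriangleBound m P) where

  InBlock : ℕ → ℕ → Pair → Set
  InBlock K s (i , j) = ∃[ i₀ ] ∃[ j₀ ] (ShortIn P K (i₀ , j₀) × i ≡ i₀ + k i₀ j₀ s * m × j ≡ j₀ + s * m)

  reduce : Pair → Pair
  reduce (i , j) = i % m , j % m

  reduce-InBlock : ∀ {s i₀ j₀} → P i₀ j₀ → reduce (i₀ + k i₀ j₀ s * m , j₀ + s * m) ≡ (i₀ , j₀)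
  reduce-InBlock {s = s} {i₀} {j₀} pij = cong₂ _,_
    (trans ([m+kn]%n≡m%n i₀ (k i₀ j₀ s) m) (m<n⇒m%n≡m (proj₁ (square pij))))
    (trans ([m+kn]%n≡m%n j₀ s m) (m<n⇒m%n≡m (proj₂ (square pij))))

  block-bound : ∀ K s {ps} → Unique ps → All (InBlock K s) ps → length ps ≤ K ⊓ m
  block-bound K s {ps} u blocks = subst (_≤ K ⊓ m) (length-map reduce ps)
    (bound K (unique-map⁺ reduce reduce-injective blocks u) (All.map⁺ (All.map short blocks)))
    where
    short : ∀ {p} → InBlock K s p → ShortIn P K (reduce p)
    short (i₀ , j₀ , sh@(pij , _) , refl , refl) = subst (ShortIn P K) (sym (reduce-InBlock {s} pij)) sh
    reduce-injective : ∀ {p q} → InBlock K s p → InBlock K s q → reduce p ≡ reduce q → p ≡ q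
    reduce-injective (i₀ , j₀ , (pij , _) , refl , refl) (i₁ , j₁ , (pkl , _) , refl , refl) e
      with trans (sym (reduce-InBlock {s} pij)) (trans e (reduce-InBlock {s} pkl))
    ... | refl = refl

  InSlices : ℕ → ℕ → Pair → Set
  InSlices K s (i , j) = BlowUp t m k P i j × i + suc j ≤ K + s * m × s * m ≤ j

  inSlices⇒inBlock : ∀ {K s p} → InSlices K s p → proj₂ p < suc s * m → InBlock K s p
  inSlices⇒inBlock {K} {s} ((i₀ , j₀ , s′ , pij , _ , refl , refl) , len , lower) upper
    with ≤-antisym (s≤s⁻¹ (*-cancelʳ-< m s′ (suc s) (≤-<-trans (m≤n+m (s′ * m) j₀) upper)))
                   (s≤s⁻¹ (*-cancelʳ-< m s (suc s′) (≤-<-trans lower (+-monoˡ-< (s′ * m) (proj₂ (square pij))))))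
  ... | refl = i₀ , j₀ , (pij , +-cancelʳ-≤ (s * m) _ K (begin
    i₀ + suc j₀ + s * m                   ≡⟨ +-assoc i₀ (suc j₀) (s * m) ⟩
    i₀ + suc (j₀ + s * m)                 ≤⟨ +-monoˡ-≤ (suc (j₀ + s * m)) (m≤m+n i₀ (k i₀ j₀ s * m)) ⟩
    i₀ + k i₀ j₀ s * m + suc (j₀ + s * m) ≤⟨ len ⟩
    K + s * m                             ∎)) , refl , refl
    where open ≤-Reasoning

  inSlices-next : ∀ {K s p} → InSlices K s p → ¬ (proj₂ p < suc s * m) → InSlices (K ∸ m) (suc s) p
  inSlices-next {K} {s} {i , j} (q , len , _) ¬upper = q , ≤-trans len (begin
    K + s * m             ≤⟨ +-monoˡ-≤ (s * m) (m≤n+m∸n K m) ⟩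
    m + (K ∸ m) + s * m   ≡⟨ cong (_+ s * m) (+-comm m (K ∸ m)) ⟩
    K ∸ m + m + s * m     ≡⟨ +-assoc (K ∸ m) m (s * m) ⟩
    K ∸ m + suc s * m     ∎) , ≮⇒≥ ¬upper
    where open ≤-Reasoning

  slices-empty : ∀ {K s p} → t ≤ s → ¬ InSlices K s p
  slices-empty {K} {s} t≤s ((i₀ , j₀ , s′ , pij , s′<t , refl , refl) , _ , lower) =
    <⇒≱ (≤-trans (+-monoˡ-< (s′ * m) (proj₂ (square pij))) (*-monoˡ-≤ m (≤-trans s′<t t≤s))) lower

  slices-bound : ∀ d s → t ≤ s + d → ∀ K {ps} → Unique ps → All (InSlices K s) ps → length ps ≤ K ⊓ (d * m)
  slices-bound zero s t≤s K u inSlices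
    rewrite All-¬⇒≡[] (slices-empty (subst (t ≤_) (+-identityʳ s) t≤s)) inSlices = z≤n
  slices-bound (suc d) s t≤s+d K {ps} u inSlices = begin
    length ps                                                 ≡⟨ sym (length-filter+filter-∁ first? ps) ⟩
    length (filter first? ps) + length (filter (∁? first?) ps) ≤⟨ +-mono-≤ first-bound rest-bound ⟩
    K ⊓ m + (K ∸ m) ⊓ (d * m)                                 ≡⟨ m⊓n+[m∸n]⊓o≡m⊓[n+o] K m (d * m) ⟩
    K ⊓ (suc d * m)                                           ∎
    where
    open ≤-Reasoning
    first? : Decidable (λ (p : Pair) → proj₂ p < suc s * m)
    first? p = proj₂ p <? suc s * m
    first-bound : length (filter first? ps) ≤ K ⊓ m
    first-bound = block-bound K s (Unique.filter⁺ first? u)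
      (All.zipWith (λ (ins , upper) → inSlices⇒inBlock {K} {s} ins upper) (All.filter⁺ first? inSlices , All.all-filter first? ps))
    rest-bound : length (filter (∁? first?) ps) ≤ (K ∸ m) ⊓ (d * m)
    rest-bound = slices-bound d (suc s) (subst (t ≤_) (+-suc s d) t≤s+d) (K ∸ m) (Unique.filter⁺ (∁? first?) u)
      (All.zipWith (λ (ins , ¬upper) → inSlices-next {K} {s} ins ¬upper) (All.filter⁺ (∁? first?) inSlices , All.all-filter (∁? first?) ps))

  bound-BlowUp : TriangleBound (t * m) (BlowUp t m k P)
  bound-BlowUp K u shorts = slices-bound t 0 ≤-refl K u
    (All.map (λ (q , len) → q , subst (_ ≤_) (sym (+-identityʳ K)) len , z≤n) shorts)

triangular-BlowUp : ∀ {t m k P} → (∀ i j s → k i j s < t) → Triangular m P → Triangular (t * m) (BlowUp t m k P)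
triangular-BlowUp {t} {zero} {k} {P} k<t (square , _) = square-BlowUp k<t square , empty
  where
  empty : TriangleBound (t * 0) (BlowUp t 0 k P)
  empty K _ shorts rewrite All-¬⇒≡[] (λ ((_ , _ , _ , pij , _) , _) → n≮0 (proj₁ (square pij))) shorts = z≤n
triangular-BlowUp {m = suc _} {k} k<t (square , bound) = square-BlowUp k<t square , BlowUpBound.bound-BlowUp {k = k} square bound

module Words {A : Set} (a b : A) (a≢b : a ≢ b) where
  open Cbc a b

  aba-injective : ∀ {i j i′ j′} → aba i j ≡ aba i′ j′ → i ≡ i′ × j ≡ j′
  aba-injective {zero} {j} {zero} {j′} e = refl , trans (sym (length-replicate j)) (trans (cong length (∷-injectiveʳ e)) (length-replicate j′))
  aba-injective {zero} {i′ = suc _} e = ⊥-elim (a≢b (sym (∷-injectiveˡ e)))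
  aba-injective {suc _} {i′ = zero} e = ⊥-elim (a≢b (∷-injectiveˡ e))
  aba-injective {suc i} {i′ = suc i′} e = Product.map₁ (cong suc) (aba-injective (∷-injectiveʳ e))

  aba≢aⁿ : ∀ i j n → aba i j ≢ replicate n a
  aba≢aⁿ zero j (suc n) e = a≢b (sym (∷-injectiveˡ e))
  aba≢aⁿ (suc i) j (suc n) e = aba≢aⁿ i j n (∷-injectiveʳ e)

  length-aba : ∀ i j → length (aba i j) ≡ i + suc j
  length-aba i j = trans (length-++ (replicate i a)) (cong₂ _+_ (length-replicate i) (cong suc (length-replicate j)))

  ≐-refl : ∀ Y → Y ≐ Y
  ≐-refl Y w = id , id

  ≐-sym : ∀ {Y Y′} → Y ≐ Y′ → Y′ ≐ Y
  ≐-sym Y≐Y′ w = Product.swap (Y≐Y′ w)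

  Exponents : WSet → PairSet
  Exponents Y i j = Y (aba i j)

  triangular-｛b｝ : ∀ {Y} → Y ≐ ｛b｝ → Triangular 1 (Exponents Y)
  triangular-｛b｝ {Y} Y≐b = triangular-origin {Exponents Y} (λ y → aba-injective (proj₁ (Y≐b _) y))

  triangular-InH : ∀ {t m Yp Y} → InH t m Yp Y → Triangular m (Exponents Yp) → Triangular (t * m) (Exponents Y)
  triangular-InH {Yp = Yp} {Y} (k , k<t , Y≐) triangular = triangular-⊆ blownUp (triangular-BlowUp k<t triangular)
    where
    blownUp : Exponents Y ⊆₂ BlowUp _ _ k (Exponents Yp)
    blownUp y with proj₁ (Y≐ _) y
    ... | i₀ , j₀ , s , yp , s<t , e with aba-injective e
    ...   | refl , refl = i₀ , j₀ , s , yp , s<t , refl , refl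

  triangular-dual : ∀ {m Y} → Triangular m (Exponents (dual Y)) → Triangular m (Exponents Y)
  triangular-dual {Y = Y} triangular = triangular-⊆ {Q = Flip (Exponents (dual Y))} (λ {i} {j} y → i , j , refl , y) (triangular-Flip triangular)

  triangular-Chain : ∀ rs {Y} → Chain rs Y → Triangular (product rs) (Exponents Y)
  triangular-Chain [] (lift Y≐b) = triangular-｛b｝ Y≐b
  triangular-Chain (t ∷ rs) {Y} (Yp , chain , inH) =
    triangular-dual {Y = Y} (triangular-InH {Yp = Yp} inH (triangular-Chain rs chain))

  triangular-Final : ∀ {t rs Y} → Final t rs Y → Triangular (t * product rs) (Exponents Y)
  triangular-Final {rs = rs} {Y} (Yp , chain , inH) = triangular-InH {Yp = Yp} {Y} inH (triangular-Chain rs chain)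

  triangular-Hajós : ∀ {n E X} → IsHajos n E → E X → ∃[ m ] Triangular m (Exponents X)
  triangular-Hajós {X = X} (inj₁ (_ , E≐b , _)) eX = 1 , triangular-｛b｝ {X} (E≐b X eX)
  triangular-Hajós {X = X} (inj₂ (_ , _ , _ , inj₁ final)) eX = _ , triangular-Final {Y = X} (final X eX)
  triangular-Hajós {X = X} (inj₂ (_ , _ , _ , inj₂ final)) eX =
    _ , triangular-dual {Y = X} (triangular-Final {Y = dual X} (final X eX))

  exponents-of : ∀ {n X ws} → InBox n X → All X ws → Σ[ ps ∈ List Pair ] map (Product.uncurry aba) ps ≡ ws
  exponents-of box [] = [] , refl
  exponents-of box (x ∷ xs) with box _ x | exponents-of box xs
  ... | i , j , _ , _ , refl | ps , refl = (i , j) ∷ ps , refl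

  triangle : ∀ {n m X} → InBox n X → TriangleBound m (Exponents X) → Triangle n X
  triangle {m = m} {X} box bound K _ ys u shorts with exponents-of box (All.map proj₁ shorts)
  ... | ps , refl = begin
    length (map (Product.uncurry aba) ps) ≡⟨ length-map _ ps ⟩
    length ps                             ≤⟨ bound K (Unique.map⁻ u) (All.map short (All.map⁻ shorts)) ⟩
    K ⊓ m                                 ≤⟨ m⊓n≤m K m ⟩
    K                                     ∎
    where
    open ≤-Reasoning
    short : ∀ {p} → Exponents X (proj₁ p) (proj₂ p) × length (Product.uncurry aba p) ≤ K → ShortIn (Exponents X) K p
    short {i , j} (x , len) = x , subst (_≤ K) (length-aba i j) len

  hajós⇒triangle : ∀ {n E X} → IsHajos n E → E X → InBox n X → Triangle n X
  hajós⇒triangle {X = X} hajós eX box = triangle box (proj₂ (proj₂ (triangular-Hajós {X = X} hajós eX)))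

-- Compositions of a cbc with itself

module Compositions {A : Set} (a b : A) (a≢b : a ≢ b) where
  open Cbc a b
  open Words a b a≢b

  -- Bool-encoded words over {a , b} make the substitution b ↦ w definable over an arbitrary alphabet.
  letter : Bool → A
  letter false = a
  letter true = b

  ⟦_⟧ : List Bool → Word
  ⟦_⟧ = map letter

  ⟦⟧-injective : ∀ {u v} → ⟦ u ⟧ ≡ ⟦ v ⟧ → u ≡ v
  ⟦⟧-injective = map-injective letter-injective
    where
    letter-injective : ∀ {x y} → letter x ≡ letter y → x ≡ y
    letter-injective {false} {false} _ = refl
    letter-injective {false} {true} e = ⊥-elim (a≢b e)
    letter-injective {true} {false} e = ⊥-elim (a≢b (sym e))
    letter-injective {true} {true} _ = refl

  ⟦replicate⟧ : ∀ m → ⟦ replicate m false ⟧ ≡ replicate m a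
  ⟦replicate⟧ m = map-replicate letter m false

  abaᵇ : ℕ → ℕ → List Bool
  abaᵇ i j = replicate i false ++ true ∷ replicate j false

  ⟦abaᵇ⟧ : ∀ i j → ⟦ abaᵇ i j ⟧ ≡ aba i j
  ⟦abaᵇ⟧ i j = trans (map-++ letter (replicate i false) _) (cong₂ _++_ (⟦replicate⟧ i) (cong (b ∷_) (⟦replicate⟧ j)))

  substitute : List Bool → List Bool → List Bool
  substitute v [] = []
  substitute v (true ∷ w) = v ++ substitute v w
  substitute v (false ∷ w) = false ∷ substitute v w

  substitute-++ : ∀ v u w → substitute v (u ++ w) ≡ substitute v u ++ substitute v w
  substitute-++ v [] w = refl
  substitute-++ v (true ∷ u) w = trans (cong (v ++_) (substitute-++ v u w)) (sym (++-assoc v _ _))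
  substitute-++ v (false ∷ u) w = cong (false ∷_) (substitute-++ v u w)

  substitute-replicate : ∀ v m → substitute v (replicate m false) ≡ replicate m false
  substitute-replicate v zero = refl
  substitute-replicate v (suc m) = cong (false ∷_) (substitute-replicate v m)

  ⟦substitute-abaᵇ⟧ : ∀ v i j → ⟦ substitute v (abaᵇ i j) ⟧ ≡ replicate i a ++ ⟦ v ⟧ ++ replicate j a
  ⟦substitute-abaᵇ⟧ v i j = begin
    ⟦ substitute v (abaᵇ i j) ⟧
      ≡⟨ cong ⟦_⟧ (substitute-++ v (replicate i false) _) ⟩
    ⟦ substitute v (replicate i false) ++ v ++ substitute v (replicate j false) ⟧
      ≡⟨ cong₂ (λ u w → ⟦ u ++ v ++ w ⟧) (substitute-replicate v i) (substitute-replicate v j) ⟩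
    ⟦ replicate i false ++ v ++ replicate j false ⟧
      ≡⟨ map-++ letter (replicate i false) _ ⟩
    ⟦ replicate i false ⟧ ++ ⟦ v ++ replicate j false ⟧
      ≡⟨ cong₂ _++_ (⟦replicate⟧ i) (map-++ letter v _) ⟩
    replicate i a ++ ⟦ v ⟧ ++ ⟦ replicate j false ⟧
      ≡⟨ cong (λ w → replicate i a ++ ⟦ v ⟧ ++ w) (⟦replicate⟧ j) ⟩
    replicate i a ++ ⟦ v ⟧ ++ replicate j a
      ∎
    where open ≡-Reasoning

  module Gaps (n : ℕ) .{{_ : NonZero n}} where

    aⁿ : Word
    aⁿ = replicate n a

    -- Between a^i b a^j and a^k b a^l this leaves an a-run of length n + (j + k) mod n (concat-gap).
    gap : ℕ → ℕ → List Word
    gap j k with j + k <? n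
    ... | yes _ = aⁿ ∷ []
    ... | no _ = []

    gap-cases : ∀ j k → gap j k ≡ [] ⊎ gap j k ≡ aⁿ ∷ []
    gap-cases j k with j + k <? n
    ... | yes _ = inj₂ refl
    ... | no _ = inj₁ refl

    gap-∈ : ∀ Y j k → All (withAn n Y) (gap j k)
    gap-∈ Y j k with j + k <? n
    ... | yes _ = inj₁ refl ∷ []
    ... | no _ = []

    concat-gap : ∀ {j k} → j < n → k < n → replicate j a ++ concat (gap j k) ++ replicate k a ≡ replicate (n + (j + k) % n) a
    concat-gap {j} {k} j<n k<n with j + k <? n
    ... | yes j+k<n = begin
      replicate j a ++ (aⁿ ++ []) ++ replicate k a ≡⟨ cong (λ w → replicate j a ++ w ++ replicate k a) (++-identityʳ aⁿ) ⟩
      replicate j a ++ aⁿ ++ replicate k a         ≡⟨ cong (replicate j a ++_) (replicate-++ n k a) ⟩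
      replicate j a ++ replicate (n + k) a         ≡⟨ replicate-++ j (n + k) a ⟩
      replicate (j + (n + k)) a                    ≡⟨ cong (λ e → replicate e a) (x∙yz≈y∙xz j n k) ⟩
      replicate (n + (j + k)) a                    ≡⟨ cong (λ e → replicate (n + e) a) (sym (m<n⇒m%n≡m j+k<n)) ⟩
      replicate (n + (j + k) % n) a                ∎
      where open ≡-Reasoning
    ... | no j+k≮n = trans (replicate-++ j k a) (cong (λ e → replicate e a) (sym (n+[j+k]%n≡j+k j<n k<n (≮⇒≥ j+k≮n))))

    gap-cancel : ∀ {g g′ i j i′ j′ s s′} → g ≡ [] ⊎ g ≡ aⁿ ∷ [] → g′ ≡ [] ⊎ g′ ≡ aⁿ ∷ [] →
      g ++ aba i j ∷ s ≡ g′ ++ aba i′ j′ ∷ s′ → g ≡ g′ × aba i j ∷ s ≡ aba i′ j′ ∷ s′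
    gap-cancel (inj₁ refl) (inj₁ refl) e = refl , e
    gap-cancel {i = i} {j} (inj₁ refl) (inj₂ refl) e = ⊥-elim (aba≢aⁿ i j n (∷-injectiveˡ e))
    gap-cancel {i′ = i′} {j′} (inj₂ refl) (inj₁ refl) e = ⊥-elim (aba≢aⁿ i′ j′ n (sym (∷-injectiveˡ e)))
    gap-cancel (inj₂ refl) (inj₂ refl) e = refl , ∷-injectiveʳ e

    -- A run of m + 1 listed words of Z is determined by its concatenation (Z ∪ {aⁿ} is a code), hence
    -- by m + 2 numbers below n: the first exponent and the a-runs modulo n. So N ^ (m + 1) ≤ n ^ (m + 2).
    module SizeBound {Z : WSet} (box : InBox n Z) (code : IsCode (withAn n Z))
                     {zs : List Pair} (u : Unique zs) (zs∈Z : All (Product.uncurry (Exponents Z)) zs) where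

      N : ℕ
      N = length zs

      I J : Fin N → ℕ
      I t = proj₁ (List.lookup zs t)
      J t = proj₂ (List.lookup zs t)

      word : Fin N → Word
      word t = aba (I t) (J t)

      word∈Z : ∀ t → Z (word t)
      word∈Z t = All.lookup zs∈Z (∈-lookup t)

      word-injective : ∀ {t t′} → word t ≡ word t′ → t ≡ t′
      word-injective e with aba-injective e
      ... | eI , eJ = lookup-injective u (cong₂ _,_ eI eJ)

      I<n : ∀ t → I t < n
      I<n t with box _ (word∈Z t)
      ... | _ , _ , i<n , _ , e with aba-injective e
      ...   | refl , refl = i<n
      J<n : ∀ t → J t < n
      J<n t with box _ (word∈Z t)
      ... | _ , _ , _ , j<n , e with aba-injective e
      ...   | refl , refl = j<n

      spell links : ∀ m → (Fin (suc m) → Fin N) → List Word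
      spell m σ = word (σ Fin.zero) ∷ links m σ
      links zero σ = []
      links (suc m) σ = gap (J (σ Fin.zero)) (I (σ (Fin.suc Fin.zero))) ++ spell m (σ ∘ Fin.suc)

      spell-∈ : ∀ m σ → All (withAn n Z) (spell m σ)
      spell-∈ zero σ = inj₂ (word∈Z (σ Fin.zero)) ∷ []
      spell-∈ (suc m) σ = inj₂ (word∈Z (σ Fin.zero)) ∷ All.++⁺ (gap-∈ Z _ _) (spell-∈ m (σ ∘ Fin.suc))

      spell-injective : ∀ m {σ σ′} → spell m σ ≡ spell m σ′ → ∀ t → σ t ≡ σ′ t
      spell-injective zero e Fin.zero = word-injective (∷-injectiveˡ e)
      spell-injective (suc m) e Fin.zero = word-injective (∷-injectiveˡ e)
      spell-injective (suc m) e (Fin.suc t) =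
        spell-injective m (proj₂ (gap-cancel (gap-cases _ _) (gap-cases _ _) (∷-injectiveʳ e))) t

      residues : ∀ m → (Fin (suc m) → Fin N) → Fin (suc m) → Fin n
      residues zero σ Fin.zero = fromℕ< (J<n (σ Fin.zero))
      residues (suc m) σ Fin.zero = (J (σ Fin.zero) + I (σ (Fin.suc Fin.zero))) mod n
      residues (suc m) σ (Fin.suc t) = residues m (σ ∘ Fin.suc) t

      signature : ∀ m → (Fin (suc m) → Fin N) → Fin (suc (suc m)) → Fin n
      signature m σ Fin.zero = fromℕ< (I<n (σ Fin.zero))
      signature m σ (Fin.suc t) = residues m σ t

      trail : ∀ m → (Fin (suc m) → Fin n) → Word
      trail zero r = b ∷ replicate (toℕ (r Fin.zero)) a
      trail (suc m) r = b ∷ replicate (n + toℕ (r Fin.zero)) a ++ trail m (r ∘ Fin.suc)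

      trail-cong : ∀ m {r r′} → (∀ t → r t ≡ r′ t) → trail m r ≡ trail m r′
      trail-cong zero r≗r′ = cong (λ x → b ∷ replicate (toℕ x) a) (r≗r′ Fin.zero)
      trail-cong (suc m) r≗r′ =
        cong₂ (λ x w → b ∷ replicate (n + toℕ x) a ++ w) (r≗r′ Fin.zero) (trail-cong m (r≗r′ ∘ Fin.suc))

      concat-spell : ∀ m σ → concat (spell m σ) ≡ replicate (I (σ Fin.zero)) a ++ trail m (residues m σ)
      concat-spell zero σ =
        trans (++-identityʳ _) (cong (λ x → replicate (I (σ Fin.zero)) a ++ b ∷ replicate x a) (sym (toℕ-fromℕ< _)))
      concat-spell (suc m) σ = begin
        aba I₀ J₀ ++ concat (G ++ S)
          ≡⟨ ++-assoc (replicate I₀ a) (b ∷ replicate J₀ a) _ ⟩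
        a^ I₀ ++ b ∷ a^ J₀ ++ concat (G ++ S)
          ≡⟨ cong (λ w → a^ I₀ ++ b ∷ a^ J₀ ++ w) (sym (concat-++ G S)) ⟩
        a^ I₀ ++ b ∷ a^ J₀ ++ concat G ++ concat S
          ≡⟨ cong (λ w → a^ I₀ ++ b ∷ a^ J₀ ++ concat G ++ w) (concat-spell m (σ ∘ Fin.suc)) ⟩
        a^ I₀ ++ b ∷ a^ J₀ ++ concat G ++ a^ I₁ ++ T
          ≡⟨ cong (λ w → a^ I₀ ++ b ∷ w) (sym (regroup (a^ J₀) (concat G) (a^ I₁) T)) ⟩
        a^ I₀ ++ b ∷ (a^ J₀ ++ concat G ++ a^ I₁) ++ T
          ≡⟨ cong (λ w → a^ I₀ ++ b ∷ w ++ T) (concat-gap (J<n (σ Fin.zero)) (I<n (σ (Fin.suc Fin.zero)))) ⟩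
        a^ I₀ ++ b ∷ a^ (n + (J₀ + I₁) % n) ++ T
          ≡⟨ cong (λ x → a^ I₀ ++ b ∷ a^ (n + x) ++ T) (sym (toℕ-fromℕ< _)) ⟩
        a^ I₀ ++ trail (suc m) (residues (suc m) σ)
          ∎
        where
        open ≡-Reasoning
        a^ : ℕ → Word
        a^ k = replicate k a
        I₀ J₀ I₁ : ℕ
        I₀ = I (σ Fin.zero)
        J₀ = J (σ Fin.zero)
        I₁ = I (σ (Fin.suc Fin.zero))
        G S : List Word
        G = gap J₀ I₁
        S = spell m (σ ∘ Fin.suc)
        T : Word
        T = trail m (residues m (σ ∘ Fin.suc))
        regroup : ∀ (w x y z : Word) → (w ++ x ++ y) ++ z ≡ w ++ x ++ y ++ z
        regroup w x y z = trans (++-assoc w (x ++ y) z) (cong (w ++_) (++-assoc x y z))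

      signature-injective : ∀ m {σ σ′} → (∀ t → signature m σ t ≡ signature m σ′ t) → ∀ t → σ t ≡ σ′ t
      signature-injective m {σ} {σ′} same = spell-injective m (code _ _ (spell-∈ m σ) (spell-∈ m σ′) (begin
        concat (spell m σ)
          ≡⟨ concat-spell m σ ⟩
        replicate (I (σ Fin.zero)) a ++ trail m (residues m σ)
          ≡⟨ cong₂ (λ i w → replicate i a ++ w) same-I (trail-cong m (same ∘ Fin.suc)) ⟩
        replicate (I (σ′ Fin.zero)) a ++ trail m (residues m σ′)
          ≡⟨ sym (concat-spell m σ′) ⟩
        concat (spell m σ′)
          ∎))
        where
        open ≡-Reasoning
        same-I : I (σ Fin.zero) ≡ I (σ′ Fin.zero)
        same-I = trans (sym (toℕ-fromℕ< _)) (trans (cong toℕ (same Fin.zero)) (toℕ-fromℕ< _))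

      encode : ∀ m → Fin (N ^ suc m) → Fin (n ^ suc (suc m))
      encode m x = funToFin (signature m (finToFun x))

      encode-injective : ∀ m {x y} → encode m x ≡ encode m y → x ≡ y
      encode-injective m {x} {y} e = trans (sym (funToFin-finToFin {suc m} {N} x))
        (trans (funToFin-cong (signature-injective m same)) (funToFin-finToFin {suc m} {N} y))
        where
        same : ∀ t → signature m (finToFun x) t ≡ signature m (finToFun y) t
        same t = trans (sym (finToFun-funToFin {suc (suc m)} {n} (signature m (finToFun x)) t))
                       (trans (cong (λ z → finToFun z t) e) (finToFun-funToFin {suc (suc m)} {n} (signature m (finToFun y)) t))

      length≤n : N ≤ n
      length≤n = ≤-of-^-bounds (λ m → injective⇒≤ (encode-injective m))

    module Powers {X : WSet} (box : InBox n X) (code : IsCode (withAn n X)) where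

      -- Power (r_k ∷ ⋯ ∷ r₁ ∷ []) = X ∘_{r₁} X ∘ ⋯ ∘_{r_k} X: the residues are listed in reverse.
      Power : List ℕ → WSet
      Power [] = X
      Power (r ∷ R) = comp n (Power R) r X

      data Spelling : List ℕ → ℕ → ℕ → Set where
        single : ∀ {i l} → X (aba i l) → Spelling [] i l
        extend : ∀ {R r i j k l} → Spelling R i j → X (aba k l) → (j + k) % n ≡ r → Spelling (r ∷ R) i l

      factors : ∀ {R i l} → Spelling R i l → List Word
      factors (single {i} {l} _) = aba i l ∷ []
      factors (extend {j = j} {k} {l} s _ _) = factors s ++ gap j k ++ aba k l ∷ []

      factors-∈ : ∀ {R i l} (s : Spelling R i l) → All (withAn n X) (factors s)
      factors-∈ (single x) = inj₂ x ∷ []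
      factors-∈ (extend {j = j} {k} s x _) = All.++⁺ (factors-∈ s) (All.++⁺ (gap-∈ X j k) (inj₂ x ∷ []))

      square : ∀ {k l} → X (aba k l) → k < n × l < n
      square x with box _ x
      ... | _ , _ , k<n , l<n , e with aba-injective e
      ...   | refl , refl = k<n , l<n

      spelling-square : ∀ {R i l} → Spelling R i l → i < n × l < n
      spelling-square (single x) = square x
      spelling-square (extend s x _) = proj₁ (spelling-square s) , proj₂ (square x)

      skeleton : List ℕ → Word
      skeleton [] = b ∷ []
      skeleton (r ∷ R) = skeleton R ++ replicate (n + r) a ++ b ∷ []

      concat-factors : ∀ {R i l} (s : Spelling R i l) → concat (factors s) ≡ replicate i a ++ skeleton R ++ replicate l a
      concat-factors (single {i} {l} _) = ++-identityʳ (aba i l)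
      concat-factors {r ∷ R} {i} {l} (extend {j = j} {k} s x refl) = begin
        concat (factors s ++ G ++ aba k l ∷ [])
          ≡⟨ sym (concat-++ (factors s) _) ⟩
        concat (factors s) ++ concat (G ++ aba k l ∷ [])
          ≡⟨ cong₂ _++_ (concat-factors s) (sym (concat-++ G _)) ⟩
        (a^ i ++ skeleton R ++ a^ j) ++ concat G ++ aba k l ++ []
          ≡⟨ regroup₁ (a^ i) (skeleton R) (a^ j) (concat G) (a^ k) (b ∷ []) (a^ l) ⟩
        a^ i ++ skeleton R ++ (a^ j ++ concat G ++ a^ k) ++ b ∷ a^ l
          ≡⟨ cong (λ w → a^ i ++ skeleton R ++ w ++ b ∷ a^ l) gap-filled ⟩
        a^ i ++ skeleton R ++ a^ (n + (j + k) % n) ++ b ∷ a^ l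
          ≡⟨ regroup₂ (a^ i) (skeleton R) (a^ (n + (j + k) % n)) (b ∷ []) (a^ l) ⟩
        a^ i ++ skeleton ((j + k) % n ∷ R) ++ a^ l
          ∎
        where
        open ≡-Reasoning
        a^ : ℕ → Word
        a^ m = replicate m a
        G : List Word
        G = gap j k
        gap-filled : a^ j ++ concat G ++ a^ k ≡ a^ (n + (j + k) % n)
        gap-filled = concat-gap (proj₂ (spelling-square s)) (proj₁ (square x))
        regroup₁ : ∀ (p q r s t v w : Word) → (p ++ q ++ r) ++ s ++ (t ++ v ++ w) ++ [] ≡ p ++ q ++ (r ++ s ++ t) ++ v ++ w
        regroup₁ p q r s t v w = solve (++-monoid A)
        regroup₂ : ∀ (p q r v w : Word) → p ++ q ++ r ++ v ++ w ≡ p ++ (q ++ r ++ v) ++ w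
        regroup₂ p q r v w = solve (++-monoid A)

      Alternating : ℕ → List Word → Set
      Alternating zero L = ∃[ i ] ∃[ j ] (L ≡ aba i j ∷ [])
      Alternating (suc m) L = ∃[ i ] ∃[ j ] ∃[ g ] ∃[ L′ ]
        ((g ≡ [] ⊎ g ≡ aⁿ ∷ []) × Alternating m L′ × L ≡ aba i j ∷ g ++ L′)

      alternating-head : ∀ m {L} → Alternating m L → ∃[ i ] ∃[ j ] ∃[ L′ ] (L ≡ aba i j ∷ L′)
      alternating-head zero (i , j , e) = i , j , [] , e
      alternating-head (suc m) (i , j , g , L′ , _ , _ , e) = i , j , g ++ L′ , e

      alternating-snoc : ∀ m {L g} i j → Alternating m L → g ≡ [] ⊎ g ≡ aⁿ ∷ [] → Alternating (suc m) (L ++ g ++ aba i j ∷ [])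
      alternating-snoc zero {g = g} i j (i₀ , j₀ , refl) g-gap = i₀ , j₀ , g , aba i j ∷ [] , g-gap , (i , j , refl) , refl
      alternating-snoc (suc m) {g = g} i j (i₀ , j₀ , g₀ , L₀ , g₀-gap , alt , refl) g-gap =
        i₀ , j₀ , g₀ , L₀ ++ g ++ aba i j ∷ [] , g₀-gap , alternating-snoc m i j alt g-gap , cong (aba i₀ j₀ ∷_) (++-assoc g₀ L₀ _)

      alternating-cancel : ∀ m {L L′ s s′} → Alternating m L → Alternating m L′ → L ++ s ≡ L′ ++ s′ → L ≡ L′ × s ≡ s′
      alternating-cancel zero (i , j , refl) (i′ , j′ , refl) e = cong (_∷ []) (∷-injectiveˡ e) , ∷-injectiveʳ e
      alternating-cancel (suc m) {s = s} {s′} (i , j , g , L₁ , g-gap , alt , refl) (i′ , j′ , g′ , L₁′ , g′-gap , alt′ , refl) e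
        with alternating-head m alt | alternating-head m alt′
      ... | _ , _ , _ , refl | _ , _ , _ , refl with ∷-injective e
      ...   | e-head , e-tail with gap-cancel g-gap g′-gap (trans (sym (++-assoc g L₁ s)) (trans e-tail (++-assoc g′ L₁′ s′)))
      ...     | refl , e-rest with alternating-cancel m alt alt′ e-rest
      ...       | e-L , e-s = cong₂ (λ x L → x ∷ g ++ L) e-head e-L , e-s

      factors-alternating : ∀ {R i l} (s : Spelling R i l) → Alternating (length R) (factors s)
      factors-alternating (single {i} {l} _) = i , l , refl
      factors-alternating (extend {R} {j = j} {k} {l} s _ _) = alternating-snoc (length R) k l (factors-alternating s) (gap-cases j k)

      factors-ends : ∀ {R i l} (s : Spelling R i l) → (∃[ j ] ∃[ L ] (factors s ≡ aba i j ∷ L)) × (∃[ k ] ∃[ L ] (factors s ≡ L ++ aba k l ∷ []))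
      factors-ends (single {i} {l} _) = (l , [] , refl) , (i , [] , refl)
      factors-ends (extend {j = j} {k} {l} s _ _) with factors-ends s
      ... | (j₀ , L , e) , _ = (j₀ , L ++ gap j k ++ aba k l ∷ [] , cong (_++ gap j k ++ aba k l ∷ []) e) ,
                              (k , factors s ++ gap j k , sym (++-assoc (factors s) (gap j k) _))

      factors-injective : ∀ {R R′ i l i′ l′} (s : Spelling R i l) (s′ : Spelling R′ i′ l′) → factors s ≡ factors s′ → i ≡ i′ × l ≡ l′
      factors-injective s s′ e with factors-ends s | factors-ends s′
      ... | (_ , _ , e₁) , (_ , L , e₂) | (_ , _ , e₁′) , (_ , L′ , e₂′) =
        proj₁ (aba-injective (∷-injectiveˡ (trans (sym e₁) (trans e e₁′)))) ,
        proj₂ (aba-injective (∷ʳ-injectiveʳ L L′ (trans (sym e₂) (trans e e₂′))))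

      ModEq⇒% : ∀ {u r} → r < n → ModEq n u r → u % n ≡ r
      ModEq⇒% {r = r} r<n (q , refl) = trans ([m+kn]%n≡m%n r q n) (m<n⇒m%n≡m r<n)

      %⇒ModEq : ∀ {u r} → u % n ≡ r → ModEq n u r
      %⇒ModEq {u} refl = u / n , m≡m%n+[m/n]*n u n

      power⇒spelling : ∀ {R} → All (_< n) R → ∀ {w} → Power R w → ∃[ i ] ∃[ l ] (w ≡ aba i l × Spelling R i l)
      power⇒spelling [] x with box _ x
      ... | i , l , _ , _ , refl = i , l , refl , single x
      power⇒spelling (r<n ∷ R<n) (i , j , k , l , refl , z , x , mod) with power⇒spelling R<n z
      ... | _ , _ , e , s with aba-injective e
      ...   | refl , refl = i , l , refl , extend s x (ModEq⇒% r<n mod)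

      spelling⇒power : ∀ {R i l} → Spelling R i l → Power R (aba i l)
      spelling⇒power (single x) = x
      spelling⇒power (extend {i = i} {j} {k} {l} s x mod) = i , j , k , l , refl , spelling⇒power s , x , %⇒ModEq mod

      box-Power : ∀ {R} → All (_< n) R → InBox n (Power R)
      box-Power R<n _ z with power⇒spelling R<n z
      ... | i , l , e , s = i , l , proj₁ (spelling-square s) , proj₂ (spelling-square s) , e

      skeletonᵇ : List ℕ → List Bool
      skeletonᵇ [] = true ∷ []
      skeletonᵇ (r ∷ R) = skeletonᵇ R ++ replicate (n + r) false ++ true ∷ []

      ⟦skeletonᵇ⟧ : ∀ R → ⟦ skeletonᵇ R ⟧ ≡ skeleton R
      ⟦skeletonᵇ⟧ [] = refl
      ⟦skeletonᵇ⟧ (r ∷ R) = trans (map-++ letter (skeletonᵇ R) _) (cong₂ _++_ (⟦skeletonᵇ⟧ R)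
        (trans (map-++ letter (replicate (n + r) false) _) (cong (_++ b ∷ []) (⟦replicate⟧ (n + r)))))

      -- Substituting the skeleton for b sends a^i b a^l ∈ Power R to the concatenation of its spelling.
      module PowerCode {R : List ℕ} (R<n : All (_< n) R) where

        Pieces : List Word → Word → Set
        Pieces ws w = (ws ≡ aⁿ ∷ [] × w ≡ aⁿ) ⊎ (∃[ i ] ∃[ l ] Σ[ s ∈ Spelling R i l ] (ws ≡ factors s × w ≡ aba i l))

        record Expansion (w : Word) : Set where
          constructor expansion
          field
            bits : List Bool
            pieces : List Word
            ⟦bits⟧ : ⟦ bits ⟧ ≡ w
            concat-pieces : concat pieces ≡ ⟦ substitute (skeletonᵇ R) bits ⟧
            pieces-∈ : All (withAn n X) pieces
            shape : Pieces pieces w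

        open Expansion

        expand : ∀ {w} → withAn n (Power R) w → Expansion w
        expand (inj₁ refl) = expansion (replicate n false) (aⁿ ∷ []) (⟦replicate⟧ n)
          (trans (++-identityʳ aⁿ) (trans (sym (⟦replicate⟧ n)) (cong ⟦_⟧ (sym (substitute-replicate _ n)))))
          (inj₁ refl ∷ []) (inj₁ (refl , refl))
        expand (inj₂ z) with power⇒spelling R<n z
        ... | i , l , refl , s = expansion (abaᵇ i l) (factors s) (⟦abaᵇ⟧ i l)
          (trans (concat-factors s) (trans (cong (λ u → replicate i a ++ u ++ replicate l a) (sym (⟦skeletonᵇ⟧ R)))
                                           (sym (⟦substitute-abaᵇ⟧ _ i l))))
          (factors-∈ s) (inj₂ (i , l , s , refl , refl))

        allBits : ∀ {ws} → All Expansion ws → List Bool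
        allBits [] = []
        allBits (e ∷ es) = bits e ++ allBits es

        allPieces : ∀ {ws} → All Expansion ws → List Word
        allPieces [] = []
        allPieces (e ∷ es) = pieces e ++ allPieces es

        ⟦allBits⟧ : ∀ {ws} (es : All Expansion ws) → ⟦ allBits es ⟧ ≡ concat ws
        ⟦allBits⟧ [] = refl
        ⟦allBits⟧ (e ∷ es) = trans (map-++ letter (bits e) _) (cong₂ _++_ (⟦bits⟧ e) (⟦allBits⟧ es))

        concat-allPieces : ∀ {ws} (es : All Expansion ws) → concat (allPieces es) ≡ ⟦ substitute (skeletonᵇ R) (allBits es) ⟧
        concat-allPieces [] = refl
        concat-allPieces (e ∷ es) = begin
          concat (pieces e ++ allPieces es)                       ≡⟨ sym (concat-++ (pieces e) (allPieces es)) ⟩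
          concat (pieces e) ++ concat (allPieces es)              ≡⟨ cong₂ _++_ (concat-pieces e) (concat-allPieces es) ⟩
          ⟦ substitute B (bits e) ⟧ ++ ⟦ substitute B (allBits es) ⟧ ≡⟨ sym (map-++ letter (substitute B (bits e)) _) ⟩
          ⟦ substitute B (bits e) ++ substitute B (allBits es) ⟧  ≡⟨ cong ⟦_⟧ (sym (substitute-++ B (bits e) (allBits es))) ⟩
          ⟦ substitute B (bits e ++ allBits es) ⟧                 ∎
          where
          open ≡-Reasoning
          B : List Bool
          B = skeletonᵇ R

        allPieces-∈ : ∀ {ws} (es : All Expansion ws) → All (withAn n X) (allPieces es)
        allPieces-∈ [] = []
        allPieces-∈ (e ∷ es) = All.++⁺ (pieces-∈ e) (allPieces-∈ es)

        pieces-nonempty : ∀ {ws w} → Pieces ws w → ∃[ x ] ∃[ ws′ ] (ws ≡ x ∷ ws′)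
        pieces-nonempty (inj₁ (refl , _)) = aⁿ , [] , refl
        pieces-nonempty (inj₂ (i , l , s , refl , _)) with proj₁ (factors-ends s)
        ... | j , L , e = aba i j , L , e

        allPieces-injective : ∀ {ws ws′} (es : All Expansion ws) (es′ : All Expansion ws′) →
          allPieces es ≡ allPieces es′ → ws ≡ ws′
        allPieces-injective [] [] _ = refl
        allPieces-injective [] (expansion _ _ _ _ _ sh ∷ _) e with pieces-nonempty sh
        ... | _ , _ , refl with e
        ...   | ()
        allPieces-injective (expansion _ _ _ _ _ sh ∷ _) [] e with pieces-nonempty sh
        ... | _ , _ , refl with e
        ...   | ()
        allPieces-injective (expansion _ _ _ _ _ (inj₁ (refl , refl)) ∷ es)
                            (expansion _ _ _ _ _ (inj₁ (refl , refl)) ∷ es′) e =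
          cong (aⁿ ∷_) (allPieces-injective es es′ (∷-injectiveʳ e))
        allPieces-injective (expansion _ _ _ _ _ (inj₁ (refl , refl)) ∷ es)
                            (expansion _ _ _ _ _ (inj₂ (i , _ , s , refl , refl)) ∷ es′) e
          with proj₁ (factors-ends s)
        ... | j , L , e′ = ⊥-elim (aba≢aⁿ i j n (sym (∷-injectiveˡ (trans e (cong (_++ allPieces es′) e′)))))
        allPieces-injective (expansion _ _ _ _ _ (inj₂ (i , _ , s , refl , refl)) ∷ es)
                            (expansion _ _ _ _ _ (inj₁ (refl , refl)) ∷ es′) e
          with proj₁ (factors-ends s)
        ... | j , L , e′ = ⊥-elim (aba≢aⁿ i j n (∷-injectiveˡ (trans (sym (cong (_++ allPieces es) e′)) e)))
        allPieces-injective (expansion _ _ _ _ _ (inj₂ (i , l , s , refl , refl)) ∷ es)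
                            (expansion _ _ _ _ _ (inj₂ (_ , _ , s′ , refl , refl)) ∷ es′) e
          with alternating-cancel (length R) (factors-alternating s) (factors-alternating s′) e
        ... | same-factors , same-rest with factors-injective s s′ same-factors
        ...   | refl , refl = cong (aba i l ∷_) (allPieces-injective es es′ same-rest)

        power-code : IsCode (withAn n (Power R))
        power-code ws ws′ ws∈ ws′∈ e = allPieces-injective es es′ (code _ _ (allPieces-∈ es) (allPieces-∈ es′) (begin
          concat (allPieces es)                       ≡⟨ concat-allPieces es ⟩
          ⟦ substitute (skeletonᵇ R) (allBits es) ⟧  ≡⟨ cong (⟦_⟧ ∘ substitute (skeletonᵇ R)) same-bits ⟩
          ⟦ substitute (skeletonᵇ R) (allBits es′) ⟧ ≡⟨ sym (concat-allPieces es′) ⟩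
          concat (allPieces es′)                      ∎))
          where
          open ≡-Reasoning
          es : All Expansion ws
          es = All.map expand ws∈
          es′ : All Expansion ws′
          es′ = All.map expand ws′∈
          same-bits : allBits es ≡ allBits es′
          same-bits = ⟦⟧-injective (trans (⟦allBits⟧ es) (trans e (sym (⟦allBits⟧ es′))))

      record Enumeration (R : List ℕ) : Set where
        field
          elements : List Pair
          unique : Unique elements
          size : length elements ≡ n
          sound : ∀ {p} → p ∈ elements → Spelling R (proj₁ p) (proj₂ p)
          complete : ∀ {i l} → Spelling R i l → (i , l) ∈ elements

      open Enumeration

      enumeration-X : HasSize X n → Enumeration []
      enumeration-X (xs , u , length-xs , xs≈X) with exponents-of box (All.tabulate (proj₂ (xs≈X _)))
      ... | ps , refl = record
        { elements = ps
        ; unique = Unique.map⁻ u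
        ; size = trans (sym (length-map _ ps)) length-xs
        ; sound = λ p∈ → single (proj₂ (xs≈X _) (∈-map⁺ _ p∈))
        ; complete = complete-X
        }
        where
        complete-X : ∀ {i l} → Spelling [] i l → (i , l) ∈ ps
        complete-X (single x) with ∈-map⁻ _ (proj₁ (xs≈X _) x)
        ... | p , p∈ , e with aba-injective e
        ...   | refl , refl = p∈

      module Join {R : List ℕ} (R<n : All (_< n) R) (E₀ : Enumeration []) (E : Enumeration R) where

        pairs : List (Pair × Pair)
        pairs = cartesianProduct (elements E) (elements E₀)

        residue : Pair × Pair → ℕ
        residue ((_ , j) , (k , _)) = (j + k) % n

        endpoints : Pair × Pair → Pair
        endpoints ((i , _) , (_ , l)) = i , l

        Joinable : ℕ → Pair × Pair → Set
        Joinable r (p , q) = (p ∈ elements E × q ∈ elements E₀) × residue (p , q) ≡ r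

        joinable : ∀ r → All (Joinable r) (fibre residue r pairs)
        joinable r = All.zip (All.filter⁺ _ (All.tabulate (∈-cartesianProduct⁻ (elements E) (elements E₀))) ,
                              All.all-filter _ pairs)

        join : ∀ {r pq} → Joinable r pq → Spelling (r ∷ R) (proj₁ (endpoints pq)) (proj₂ (endpoints pq))
        join ((p∈ , q∈) , mod) = extend (sound E p∈) (spelled (sound E₀ q∈)) mod
          where
          spelled : ∀ {k l} → Spelling [] k l → X (aba k l)
          spelled (single x) = x

        same-factors : ∀ {r pq pq′} (J : Joinable r pq) (J′ : Joinable r pq′) →
          endpoints pq ≡ endpoints pq′ → factors (join J) ≡ factors (join J′)
        same-factors {pq = (i , _) , (_ , l)} J J′ refl =
          code _ _ (factors-∈ (join J)) (factors-∈ (join J′))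
            (trans (concat-factors (join J)) (sym (concat-factors (join J′))))

        endpoints-injective : ∀ {r pq pq′} → Joinable r pq → Joinable r pq′ → endpoints pq ≡ endpoints pq′ → pq ≡ pq′
        endpoints-injective {pq = (i , j) , (k , l)} {(_ , j′) , (k′ , _)} J@((p∈ , _) , _) J′@((p∈′ , _) , _) e
          with alternating-cancel (length R) (factors-alternating (sound E p∈)) (factors-alternating (sound E p∈′))
                                  (same-factors J J′ e)
        ... | same-prefix , same-suffix
          with e | proj₂ (factors-injective (sound E p∈) (sound E p∈′) same-prefix)
             | gap-cancel {s = []} {s′ = []} (gap-cases j k) (gap-cases j′ k′) same-suffix
        ...   | refl | refl | _ , same-last with aba-injective (∷-injectiveˡ same-last)
        ...     | refl , refl = refl

        candidates : ℕ → List Pair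
        candidates r = map endpoints (fibre residue r pairs)

        candidates-unique : ∀ r → Unique (candidates r)
        candidates-unique r = unique-map⁺ endpoints endpoints-injective (joinable r)
          (Unique.filter⁺ _ (Unique.cartesianProduct⁺ (unique E) (unique E₀)))

        candidates-sound : ∀ r {p} → p ∈ candidates r → Spelling (r ∷ R) (proj₁ p) (proj₂ p)
        candidates-sound r p∈ with ∈-map⁻ endpoints p∈
        ... | _ , pq∈ , refl = join (All.lookup (joinable r) pq∈)

        candidates-complete : ∀ r {i l} → Spelling (r ∷ R) i l → (i , l) ∈ candidates r
        candidates-complete r (extend s x mod) =
          ∈-map⁺ endpoints (∈-filter⁺ _ (∈-cartesianProduct⁺ (complete E s) (complete E₀ (single x))) mod)

        fibre-bound : ∀ r → r < n → length (fibre residue r pairs) ≤ n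
        fibre-bound r r<n = subst (_≤ n) (length-map endpoints (fibre residue r pairs))
          (SizeBound.length≤n (box-Power (r<n ∷ R<n)) (PowerCode.power-code (r<n ∷ R<n)) (candidates-unique r)
            (All.tabulate (spelling⇒power ∘ candidates-sound r)))

        fibres-total : sumBelow n (λ r → length (fibre residue r pairs)) ≡ n * n
        fibres-total = trans (sumBelow-fibres residue n (λ _ → m%n<n _ n) pairs)
          (trans (length-cartesianProduct (elements E) (elements E₀)) (cong₂ _*_ (size E) (size E₀)))

        enumeration-∷ : ∀ r → r < n → Enumeration (r ∷ R)
        enumeration-∷ r r<n = record
          { elements = candidates r
          ; unique = candidates-unique r
          ; size = trans (length-map endpoints (fibre residue r pairs)) (sumBelow-saturated n fibre-bound fibres-total r r<n)
          ; sound = candidates-sound r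
          ; complete = candidates-complete r
          }

      enumeration : HasSize X n → ∀ {R} → All (_< n) R → Enumeration R
      enumeration size-X [] = enumeration-X size-X
      enumeration size-X (r<n ∷ R<n) = Join.enumeration-∷ R<n (enumeration-X size-X) (enumeration size-X R<n) _ r<n

      power-cbc : HasSize X n → ∀ {R} → All (_< n) R → IsCbc n (Power R)
      power-cbc size-X {R} R<n = box-Power R<n , size-Power , PowerCode.power-code R<n
        where
        E : Enumeration R
        E = enumeration size-X R<n
        size-Power : HasSize (Power R) n
        size-Power = map (Product.uncurry aba) (elements E) , Unique.map⁺ aba-injective′ (unique E) ,
                     trans (length-map _ (elements E)) (size E) , λ w → listed , unlisted
          where
          aba-injective′ : ∀ {p q : Pair} → Product.uncurry aba p ≡ Product.uncurry aba q → p ≡ q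
          aba-injective′ e with aba-injective e
          ... | refl , refl = refl
          listed : ∀ {w} → Power R w → w ∈ map (Product.uncurry aba) (elements E)
          listed z with power⇒spelling R<n z
          ... | _ , _ , refl , s = ∈-map⁺ _ (complete E s)
          unlisted : ∀ {w} → w ∈ map (Product.uncurry aba) (elements E) → Power R w
          unlisted w∈ with ∈-map⁻ _ w∈
          ... | _ , p∈ , refl = spelling⇒power (sound E p∈)

    comp-≐ : ∀ {W W′ Y Y′} r → W ≐ W′ → Y ≐ Y′ → comp n W r Y ≐ comp n W′ r Y′
    comp-≐ r W≐W′ Y≐Y′ _ =
      (λ (i , j , k , l , e , w , y , mod) → i , j , k , l , e , proj₁ (W≐W′ _) w , proj₁ (Y≐Y′ _) y , mod) ,
      (λ (i , j , k , l , e , w , y , mod) → i , j , k , l , e , proj₂ (W≐W′ _) w , proj₂ (Y≐Y′ _) y , mod)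

    cbc-≐ : ∀ {Y Y′} → Y ≐ Y′ → IsCbc n Y → IsCbc n Y′
    cbc-≐ {Y} {Y′} Y≐Y′ (box , (ws , u , length-ws , ws≈Y) , code) =
      (λ w y → box w (proj₂ (Y≐Y′ w) y)) ,
      (ws , u , length-ws , λ w → proj₁ (ws≈Y w) ∘ proj₂ (Y≐Y′ w) , proj₁ (Y≐Y′ w) ∘ proj₂ (ws≈Y w)) ,
      (λ xs ys xs∈ ys∈ → code xs ys (All.map back xs∈) (All.map back ys∈))
      where
      back : ∀ {w} → withAn n Y′ w → withAn n Y w
      back (inj₁ e) = inj₁ e
      back (inj₂ y) = inj₂ (proj₂ (Y≐Y′ _) y)

    compatible-singleton : ∀ {X} → IsCbc n X → Compatible n (_≐ X)
    compatible-singleton {X} cbc@(box , size-X , code) = (λ Y Y≐X → cbc-≐ (≐-sym Y≐X) cbc) , compositions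
      where
      open Powers box code

      compAll-≐-Power : ∀ {W R} rest → W ≐ Power R → All (λ p → proj₂ p ≐ X) rest →
        compAll n W rest ≐ Power (map proj₁ rest ʳ++ R)
      compAll-≐-Power [] W≐P [] = W≐P
      compAll-≐-Power ((r , _) ∷ rest) W≐P (Y≐X ∷ rest≐X) = compAll-≐-Power rest (comp-≐ r W≐P Y≐X) rest≐X

      compositions : ∀ Y → Y ≐ X → ∀ r Y′ rest → r < n → Y′ ≐ X →
        All (λ p → proj₁ p < n × proj₂ p ≐ X) rest → IsCbc n (compAll n Y ((r , Y′) ∷ rest))
      compositions Y Y≐X r Y′ rest r<n Y′≐X rest∈ =
        cbc-≐ (≐-sym (compAll-≐-Power rest (comp-≐ r Y≐X Y′≐X) (All.map proj₂ rest∈)))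
          (power-cbc size-X (All-ʳ++⁺ (All.map⁺ (All.map proj₁ rest∈)) (r<n ∷ [])))

mainTheorem3 : {A : Set} (a b : A) → a ≢ b → (n : ℕ) →
    Cbc.CbcHajosNumber a b n →
    ∀ (X : Cbc.WSet a b) → Cbc.IsCbc a b n X → Cbc.Triangle a b n X
mainTheorem3 a b a≢b zero _ _ _ _ ()
mainTheorem3 a b a≢b (suc n) hajós X cbc@(box , _) =
  hajós⇒triangle (hajós (_≐ X) (compatible-singleton cbc)) (≐-refl X) box
  where
  open Cbc a b
  open Words a b a≢b
  open Compositions a b a≢b
  open Gaps (suc n)
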